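{- Let $G=(V,E)$ be a finite directed graph in which every vertex has indegree greater than $0$, fix a total order on $E$, let $\langle l_v\rangle_{v\in V}$ be a tree array of $G$, and let $T'=\sigma(\langle l_v\rangle)$. Then $T'$ is an oriented spanning tree of $\mathcal{L}G$, and for every $e\in E$, $\mathrm{indeg}_{T'}(e)$ equals the number of occurrences of $e$ in the original list $l_{s(e)}$ of the tree array.
   Context: Each edge $e$ has source $s(e)$ and target $t(e)$. The directed line graph $\mathcal{L}G$ has vertex set $E$ and an edge $(e,f)$ for each pair of edges with $t(e)=s(f)$. An oriented spanning tree of a directed graph rooted at $r$ is a subgraph containing all vertices in which every vertex has a unique directed path to $r$. A list is a finite ordered tuple; popping a list removes its first element; $N(l,e)$ denotes the current number of occurrences of $e$ in list $l$. A tree array of $G$ is an assignment of a list $l_v$ to each $v\in V$ for which there exist an oriented spanning tree $T$ of $G$ with root $r$ such that: $l_v$ has length $\mathrm{indeg}(v)$; for each $v$, the first $\mathrm{indeg}(v)-1$ entries of $l_v$ are edges with source $v$; for $v\neq r$, the last entry of $l_v$ is the unique edge of $T$ with source $v$; the last entry of $l_r$ is a special symbol $\Omega$ (not an edge). The algorithm $\sigma$ starts with a tree array $\langle l_v\rangle$ and the empty subgraph $T'$ of $\mathcal{L}G$ and repeats: Step 1: let $R$ be the set of edges $e\in E$ with $N(l_{s(e)},e)=0$ and $\mathrm{outdeg}_{T'}(e)=0$, and let $f$ be the smallest element of $R$. Step 2: pop the first element $g$ from $l_{t(f)}$; if $g=\Omega$, output $T'$ and stop. Step 3: otherwise $g\in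 E$ with $s(g)=t(f)$; add the edge $(f,g)$ to $T'$ and return to Step 1. The output is denoted $\sigma(\langle l_v\rangle)$. $\mathrm{indeg}_{T'}(e)$ is the indegree of the vertex $e$ in the subgraph $T'$. -}

module Defs where

open import Data.Nat using (ℕ; zero; suc; _∸_; _≡ᵇ_)
open import Data.Fin using (Fin; _≟_)
open import Data.Fin.Subset using (Subset; _∈_)
open import Data.Fin.Permutation using (Permutation′; _⟨$⟩ˡ_)
open import Data.List using (List; []; _∷_; _++_; [_]; length; map; filterᵇ; head; allFin)
open import Data.Bool.ListAction using (any)
open import Data.Nat.ListAction using (sum)
open import Data.List.Relation.Unary.All using (All)
open import Data.Bool using (Bool; true; false; _∧_; not)
open import Data.Maybe using (Maybe; just; nothing)
open import Data.Product using (Σ; ∃; _×_; _,_; proj₁; proj₂)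
open import Relation.Nullary using (¬_; yes; no)
open import Relation.Nullary.Decidable using (⌊_⌋)
open import Relation.Binary.PropositionalEquality using (_≡_; sym)

module _ {V E : Set} (src tgt : E → V) (InT : E → Set) where

  data IsWalk : List E → V → V → Set where
    []  : ∀ {v} → IsWalk [] v v
    cons : ∀ {v e es w} → InT e → src e ≡ v → IsWalk es (tgt e) w → IsWalk (e ∷ es) v w

  -- the subgraph InT (which contains all vertices) is an oriented spanning
  -- tree rooted at r: every vertex has a unique directed walk to r in it
  OrientedSpanningTree : V → Set
  OrientedSpanningTree r =
    ∀ v → (∃ λ ws → IsWalk ws v r)
        × (∀ ws₁ ws₂ → IsWalk ws₁ v r → IsWalk ws₂ v r → ws₁ ≡ ws₂)

module _ {n m : ℕ} (s t : Fin m → Fin n) where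

  indeg : Fin n → ℕ
  indeg v = length (filterᵇ (λ e → ⌊ t e ≟ v ⌋) (allFin m))

  -- edges of the directed line graph LG: pairs (e , f) with t(e) = s(f)
  LEdge : Set
  LEdge = Σ (Fin m × Fin m) (λ p → t (proj₁ p) ≡ s (proj₂ p))

  LSrc LTgt : LEdge → Fin m
  LSrc x = proj₁ (proj₁ x)
  LTgt x = proj₂ (proj₁ x)

data Entry (m : ℕ) : Set where
  edge : Fin m → Entry m
  Ω    : Entry m

isEdge : ∀ {m} → Fin m → Entry m → Bool
isEdge e (edge f) = ⌊ f ≟ e ⌋
isEdge e Ω        = false

N : ∀ {m} → List (Entry m) → Fin m → ℕ
N l e = length (filterᵇ (isEdge e) l)

module _ {n m : ℕ} (s t : Fin m → Fin n) where

  TreeArray : (Fin n → List (Entry m)) → Set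
  TreeArray l =
    Σ (Subset m) λ T → Σ (Fin n) λ r →
      OrientedSpanningTree s t (λ e → e ∈ T) r ×
      (∀ v → length (l v) ≡ indeg s t v ×
             (∃ λ xs → ∃ λ x → l v ≡ xs ++ [ x ] ×
                All (λ y → ∃ λ e → y ≡ edge e × s e ≡ v) xs ×
                (¬ (v ≡ r) → ∃ λ e → x ≡ edge e × e ∈ T × s e ≡ v) ×
                (v ≡ r → x ≡ Ω)))

  -- the algorithm σ, with a fixed total order on E given by a permutation π
  -- (edge e precedes edge e' iff π(e) < π(e')); the k-th edge is π⁻¹(k)
  module _ (π : Permutation′ m) where

    inR : (Fin n → List (Entry m)) → List (LEdge s t) → Fin m → Bool
    inR l T' e = (N (l (s e)) e ≡ᵇ 0) ∧ not (any (λ x → ⌊ LSrc s t x ≟ e ⌋) T')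

    pick : (Fin n → List (Entry m)) → List (LEdge s t) → Maybe (Fin m)
    pick l T' = head (filterᵇ (inR l T') (map (π ⟨$⟩ˡ_) (allFin m)))

    update : (Fin n → List (Entry m)) → Fin n → List (Entry m) → Fin n → List (Entry m)
    update l w xs v with v ≟ w
    ... | yes _ = xs
    ... | no _  = l v

    -- nothing = the algorithm is stuck (R empty, popping an empty list,
    -- popped edge with wrong source) or out of fuel
    σ-loop : ℕ → (Fin n → List (Entry m)) → List (LEdge s t) → Maybe (List (LEdge s t))
    σ-loop zero l T' = nothing
    σ-loop (suc k) l T' with pick l T'
    ... | nothing = nothing
    ... | just f with l (t f)
    ...   | [] = nothing
    ...   | Ω ∷ _ = just T'
    ...   | edge g ∷ rest with s g ≟ t f
    ...     | no _  = nothing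
    ...     | yes p = σ-loop k (update l (t f) rest) (((f , g) , sym p) ∷ T')

    -- each round pops one list entry, so total list length + 1 rounds suffice
    σ : (Fin n → List (Entry m)) → Maybe (List (LEdge s t))
    σ l = σ-loop (suc (sum (map (λ v → length (l v)) (allFin n)))) l []

  indegL : List (LEdge s t) → Fin m → ℕ
  indegL T' e = length (filterᵇ (λ f → any (λ x → ⌊ LSrc s t x ≟ f ⌋ ∧ ⌊ LTgt s t x ≟ e ⌋) T') (allFin m))

-- Call an edge e open while it is not yet the source of an arc of T′.
-- We show that σ maintains an invariant (record Invariant): every list is a
-- suffix of its tree-array list; the list at v has one entry per open edge
-- into v; an edge still listed at its source is open; the arcs of T′ into e
-- together with the remaining occurrences of e make up N(l_{s(e)}, e); T′ is
-- functional; and every edge reaches an open edge along T′.  A round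
-- preserves the invariant and closes one edge (Step), so the fuel of σ
-- suffices (loop); some edge is always ready, by double counting
-- (some-ready).  When Ω is popped, following T down to r shows that the
-- ready edge f is the only open edge (Final): T′ is then an oriented
-- spanning tree rooted at f and all lists are used up.

module Submission where

open import Defs
open import Data.Nat using (ℕ; zero; suc; _+_; _≤_; _<_; z≤n; s≤s; s≤s⁻¹)
open import Data.Nat.Properties
  using ( ≤-refl; ≤-reflexive; ≤-trans; ≤-<-trans; <-irrefl; m≤n+m; +-cancelˡ-≡; +-mono-≤
        ; +-identityʳ; +-mono-<-≤; +-mono-≤-<; +-commutativeSemigroup; module ≤-Reasoning)
open import Data.Nat.ListAction using (sum)
open import Algebra.Properties.CommutativeSemigroup +-commutativeSemigroup
  using (x∙yz≈y∙xz; xy∙z≈y∙xz; interchange)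
open import Data.Fin using (Fin; _≟_) renaming (zero to fzero; suc to fsuc)
open import Data.Fin.Subset using (Subset) renaming (_∈_ to _∈ₛ_)
open import Data.Fin.Permutation using (Permutation′; _⟨$⟩ˡ_; _⟨$⟩ʳ_; inverseˡ)
open import Data.List using (List; []; _∷_; _++_; [_]; filterᵇ; head; length; allFin; map; tabulate)
open import Data.List.Properties using (∷-injectiveˡ; length-filter; map-tabulate)
open import Data.List.Relation.Unary.All using (All; []; _∷_)
open import Data.List.Relation.Unary.Any using (here; there)
open import Data.List.Membership.Propositional using (_∈_)
open import Data.List.Membership.Propositional.Properties using (∈-allFin; ∈-map⁺)
open import Data.Bool using (Bool; true; false; not; _∧_; _∨_; T?)
open import Data.Bool.ListAction using (any)
open import Data.Bool.Properties using (∧-identityʳ; ∧-zeroʳ; ∨-identityʳ)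
open import Data.Maybe using (just; nothing)
open import Data.Empty using (⊥; ⊥-elim)
open import Data.Product using (∃; _×_; _,_; proj₁; proj₂)
open import Function using (id; _∘_; case_of_)
open import Relation.Nullary using (yes; no)
open import Relation.Nullary.Decidable using (⌊_⌋; dec-true; dec-false; isYes≗does)
open import Relation.Binary.PropositionalEquality
  using (_≡_; _≢_; refl; sym; cong; cong₂; subst; module ≡-Reasoning)
  renaming (trans to infixr 5 _∙_)

count : {A : Set} → (A → Bool) → List A → ℕ
count p xs = length (filterᵇ p xs)

indicator : Bool → ℕ
indicator true  = 1
indicator false = 0

module _ {A : Set} where

  count-cons : ∀ (p : A → Bool) x xs → count p (x ∷ xs) ≡ indicator (p x) + count p xs
  count-cons p x xs with p x
  ... | true  = refl
  ... | false = refl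

  count-cong : ∀ {p q : A → Bool} xs → (∀ x → p x ≡ q x) → count p xs ≡ count q xs
  count-cong         []       p≗q = refl
  count-cong {p} {q} (x ∷ xs) p≗q = begin
    count p (x ∷ xs)               ≡⟨ count-cons p x xs ⟩
    indicator (p x) + count p xs   ≡⟨ cong₂ _+_ (cong indicator (p≗q x)) (count-cong xs p≗q) ⟩
    indicator (q x) + count q xs   ≡⟨ count-cons q x xs ⟨
    count q (x ∷ xs)               ∎
    where open ≡-Reasoning

  count-none : ∀ {p : A → Bool} xs → (∀ x → p x ≡ false) → count p xs ≡ 0
  count-none {p} xs p≗false = count-cong xs p≗false ∙ count-false xs
    where
    count-false : ∀ xs → count (λ _ → false) xs ≡ 0
    count-false []       = refl
    count-false (_ ∷ xs) = count-false xs

count-map : ∀ {A B : Set} (p : B → Bool) (f : A → B) xs →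
            count p (map f xs) ≡ count (λ x → p (f x)) xs
count-map p f []       = refl
count-map p f (x ∷ xs) with p (f x)
... | true  = cong suc (count-map p f xs)
... | false = count-map p f xs

count-allFin-suc : ∀ {k} (p : Fin (suc k) → Bool) →
  count p (allFin (suc k)) ≡ indicator (p fzero) + count (λ x → p (fsuc x)) (allFin k)
count-allFin-suc {k} p = count-cons p fzero (tabulate fsuc)
  ∙ cong (indicator (p fzero) +_) (cong (count p) (sym (map-tabulate id fsuc)) ∙ count-map p fsuc (allFin k))

∧-split : ∀ a b → a ∧ b ≡ true → a ≡ true × b ≡ true
∧-split true true _ = refl , refl

≟-refl : ∀ {k} (a : Fin k) → ⌊ a ≟ a ⌋ ≡ true
≟-refl a = isYes≗does (a ≟ a) ∙ dec-true (a ≟ a) refl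

≟-≢ : ∀ {k} {a b : Fin k} → a ≢ b → ⌊ a ≟ b ⌋ ≡ false
≟-≢ {a = a} {b} a≢b = isYes≗does (a ≟ b) ∙ dec-false (a ≟ b) a≢b

≟-sound : ∀ {k} {a b : Fin k} → ⌊ a ≟ b ⌋ ≡ true → a ≡ b
≟-sound {a = a} {b} eq with a ≟ b
... | yes a≡b = a≡b
... | no  _   = case eq of λ ()

≟-suc : ∀ {k} (a x : Fin k) → ⌊ fsuc a ≟ fsuc x ⌋ ≡ ⌊ a ≟ x ⌋
≟-suc a x with a ≟ x
... | yes _ = refl
... | no  _ = refl

count-remove : ∀ {k} (p : Fin k → Bool) (a : Fin k) →
  count p (allFin k) ≡ indicator (p a) + count (λ x → not ⌊ a ≟ x ⌋ ∧ p x) (allFin k)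
count-remove {suc k} p fzero =
  count-allFin-suc p
  ∙ cong (indicator (p fzero) +_) (sym (count-allFin-suc (λ x → not ⌊ fzero ≟ x ⌋ ∧ p x)))
count-remove {suc k} p (fsuc a) = begin
  count p (allFin (suc k))
    ≡⟨ count-allFin-suc p ⟩
  p₀ + count (λ x → p (fsuc x)) (allFin k)
    ≡⟨ cong (p₀ +_) (count-remove (λ x → p (fsuc x)) a) ⟩
  p₀ + (pₐ + count (λ x → not ⌊ a ≟ x ⌋ ∧ p (fsuc x)) (allFin k))
    ≡⟨ x∙yz≈y∙xz p₀ pₐ _ ⟩
  pₐ + (p₀ + count (λ x → not ⌊ a ≟ x ⌋ ∧ p (fsuc x)) (allFin k))
    ≡⟨ cong (λ c → pₐ + (p₀ + c))
            (count-cong (allFin k) (λ x → cong (λ b → not b ∧ p (fsuc x)) (sym (≟-suc a x)))) ⟩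
  pₐ + (p₀ + count (λ x → not ⌊ fsuc a ≟ fsuc x ⌋ ∧ p (fsuc x)) (allFin k))
    ≡⟨ cong (pₐ +_) (count-allFin-suc (λ x → not ⌊ fsuc a ≟ x ⌋ ∧ p x)) ⟨
  pₐ + count (λ x → not ⌊ fsuc a ≟ x ⌋ ∧ p x) (allFin (suc k))
    ∎
  where
  open ≡-Reasoning
  p₀ pₐ : ℕ
  p₀ = indicator (p fzero)
  pₐ = indicator (p (fsuc a))

count-positive : ∀ {k} (p : Fin k → Bool) (a : Fin k) → p a ≡ true → 0 < count p (allFin k)
count-positive p a pa rewrite count-remove p a | pa = s≤s z≤n

count-two : ∀ {k} (p : Fin k → Bool) (a b : Fin k) → a ≢ b → p a ≡ true → p b ≡ true →
            2 ≤ count p (allFin k)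
count-two p a b a≢b pa pb rewrite count-remove p a | pa =
  s≤s (count-positive (λ x → not ⌊ a ≟ x ⌋ ∧ p x) b (cong₂ (λ u v → not u ∧ v) (≟-≢ a≢b) pb))

sumOver : {A : Set} → (A → ℕ) → List A → ℕ
sumOver f xs = sum (map f xs)

module _ {A : Set} where

  sumOver-cong : ∀ {f g : A → ℕ} xs → (∀ x → f x ≡ g x) → sumOver f xs ≡ sumOver g xs
  sumOver-cong []       f≗g = refl
  sumOver-cong (x ∷ xs) f≗g = cong₂ _+_ (f≗g x) (sumOver-cong xs f≗g)

  sumOver-+ : ∀ (f g : A → ℕ) xs → sumOver (λ x → f x + g x) xs ≡ sumOver f xs + sumOver g xs
  sumOver-+ f g []       = refl
  sumOver-+ f g (x ∷ xs) =
    cong (f x + g x +_) (sumOver-+ f g xs) ∙ interchange (f x) (g x) (sumOver f xs) (sumOver g xs)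

  sumOver-indicator : ∀ (p : A → Bool) xs → sumOver (λ x → indicator (p x)) xs ≡ count p xs
  sumOver-indicator p []       = refl
  sumOver-indicator p (x ∷ xs) = cong (indicator (p x) +_) (sumOver-indicator p xs) ∙ sym (count-cons p x xs)

  sumOver-mono : ∀ {f g : A → ℕ} xs → (∀ x → f x ≤ g x) → sumOver f xs ≤ sumOver g xs
  sumOver-mono []       f≤g = z≤n
  sumOver-mono (x ∷ xs) f≤g = +-mono-≤ (f≤g x) (sumOver-mono xs f≤g)

  sumOver-< : ∀ {f g : A → ℕ} {a} xs → (∀ x → f x ≤ g x) → a ∈ xs → f a < g a →
              sumOver f xs < sumOver g xs
  sumOver-< (x ∷ xs) f≤g (here refl) fa<ga = +-mono-<-≤ fa<ga (sumOver-mono xs f≤g)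
  sumOver-< (x ∷ xs) f≤g (there a∈) fa<ga = +-mono-≤-< (f≤g x) (sumOver-< xs f≤g a∈ fa<ga)

double-counting : ∀ {A : Set} {j} (h : A → Fin j) (p : A → Bool) xs →
  sumOver (λ v → count (λ x → ⌊ h x ≟ v ⌋ ∧ p x) xs) (allFin j) ≡ count p xs
double-counting {j = j} h p [] = zero-sum (allFin j)
  where
  zero-sum : ∀ vs → sumOver {Fin j} (λ _ → 0) vs ≡ 0
  zero-sum []       = refl
  zero-sum (_ ∷ vs) = zero-sum vs
double-counting {A = A} {j = j} h p (x ∷ xs) = begin
  sumOver (λ v → count (class v) (x ∷ xs)) (allFin j)
    ≡⟨ sumOver-cong (allFin j) (λ v → count-cons (class v) x xs) ⟩
  sumOver (λ v → indicator (class v x) + count (class v) xs) (allFin j)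
    ≡⟨ sumOver-+ (λ v → indicator (class v x)) (λ v → count (class v) xs) (allFin j) ⟩
  sumOver (λ v → indicator (class v x)) (allFin j) + sumOver (λ v → count (class v) xs) (allFin j)
    ≡⟨ cong₂ _+_ (sumOver-indicator (λ v → class v x) (allFin j) ∙ one-class) (double-counting h p xs) ⟩
  indicator (p x) + count p xs
    ≡⟨ count-cons p x xs ⟨
  count p (x ∷ xs)
    ∎
  where
  open ≡-Reasoning
  class : Fin j → A → Bool
  class v y = ⌊ h y ≟ v ⌋ ∧ p y
  one-class : count (λ v → class v x) (allFin j) ≡ indicator (p x)
  one-class = count-remove (λ v → class v x) (h x)
    ∙ cong₂ _+_ (cong (λ b → indicator (b ∧ p x)) (≟-refl (h x)))
                (count-none (allFin j) other-classes)
    ∙ +-identityʳ (indicator (p x))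
    where
    other-classes : ∀ v → not ⌊ h x ≟ v ⌋ ∧ class v x ≡ false
    other-classes v with ⌊ h x ≟ v ⌋
    ... | true  = refl
    ... | false = refl

-- Walks in a subgraph
module _ {V E : Set} (src tgt : E → V) where

  walk-mono : ∀ {P Q : E → Set} {ws v w} → (∀ {x} → P x → Q x) →
              IsWalk src tgt P ws v w → IsWalk src tgt Q ws v w
  walk-mono P⊆Q []              = []
  walk-mono P⊆Q (cons px sx W)  = cons (P⊆Q px) sx (walk-mono P⊆Q W)

  walk-snoc : ∀ {P : E → Set} {ws v w} x → IsWalk src tgt P ws v w → P x → src x ≡ w →
              IsWalk src tgt P (ws ++ [ x ]) v (tgt x)
  walk-snoc x []             px sx = cons px sx []
  walk-snoc x (cons py sy W) px sx = cons py sy (walk-snoc x W px sx)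

  walk-unique : ∀ {P : E → Set} {ρ} →
                (∀ {x y} → P x → P y → src x ≡ src y → x ≡ y) → (∀ {x} → P x → src x ≢ ρ) →
                ∀ {ws₁ ws₂ v} → IsWalk src tgt P ws₁ v ρ → IsWalk src tgt P ws₂ v ρ → ws₁ ≡ ws₂
  walk-unique functional sink []              []              = refl
  walk-unique functional sink []              (cons px sx _)  = ⊥-elim (sink px sx)
  walk-unique functional sink (cons px sx _)  []              = ⊥-elim (sink px sx)
  walk-unique functional sink (cons px sx W₁) (cons py sy W₂) with functional px py (sx ∙ sym sy)
  ... | refl = cong (_ ∷_) (walk-unique functional sink W₁ W₂)

  -- In an oriented spanning tree every vertex has at most one outgoing
  -- edge: two of them would start two different walks to the root.
  tree-out-edge-unique : ∀ {P : E → Set} {r} → OrientedSpanningTree src tgt P r →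
                         ∀ {x y} → P x → P y → src x ≡ src y → x ≡ y
  tree-out-edge-unique ost {x} {y} px py sx≡sy with proj₁ (ost (tgt x)) | proj₁ (ost (tgt y))
  ... | ws , W | ws′ , W′ =
    ∷-injectiveˡ (proj₂ (ost (src x)) (x ∷ ws) (y ∷ ws′) (cons px refl W) (cons py (sym sx≡sy) W′))

module _ {A : Set} (p : A → Bool) where

  head-filter-nothing : ∀ xs → head (filterᵇ p xs) ≡ nothing → ∀ {x} → x ∈ xs → p x ≡ false
  head-filter-nothing (y ∷ xs) none x∈ with p y in py
  head-filter-nothing (y ∷ xs) ()   x∈          | true
  head-filter-nothing (y ∷ xs) none (here refl) | false = py
  head-filter-nothing (y ∷ xs) none (there x∈)  | false = head-filter-nothing xs none x∈

  head-filter-just : ∀ xs {x} → head (filterᵇ p xs) ≡ just x → p x ≡ true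
  head-filter-just (y ∷ xs) first with p y in py
  head-filter-just (y ∷ xs) refl  | true  = py
  head-filter-just (y ∷ xs) first | false = head-filter-just xs first

isEdgeEntry : ∀ {m} → Entry m → Bool
isEdgeEntry (edge _) = true
isEdgeEntry Ω        = false

N-edge : ∀ {m} (g e : Fin m) L → N (edge g ∷ L) e ≡ indicator ⌊ g ≟ e ⌋ + N L e
N-edge g e L = count-cons (isEdge e) (edge g) L

distinct-occurrences : ∀ {m} (P : Fin m → Bool) (L : List (Entry m)) →
  (∀ e → P e ≡ true → 0 < N L e) → count P (allFin m) ≤ count isEdgeEntry L
distinct-occurrences {m} P [] occurs = ≤-reflexive (count-none (allFin m) absent)
  where
  absent : ∀ e → P e ≡ false
  absent e with P e in Pe
  ... | true  = case occurs e Pe of λ ()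
  ... | false = refl
distinct-occurrences P (Ω ∷ L) occurs = distinct-occurrences P L occurs
distinct-occurrences {m} P (edge g ∷ L) occurs = begin
  count P (allFin m)                      ≡⟨ count-remove P g ⟩
  indicator (P g) + count P′ (allFin m)
    ≤⟨ +-mono-≤ (indicator≤1 (P g)) (distinct-occurrences P′ L occurs′) ⟩
  1 + count isEdgeEntry L                 ∎
  where
  open ≤-Reasoning
  P′ : Fin m → Bool
  P′ e = not ⌊ g ≟ e ⌋ ∧ P e
  indicator≤1 : ∀ b → indicator b ≤ 1
  indicator≤1 true  = ≤-refl
  indicator≤1 false = z≤n
  occurs′ : ∀ e → P′ e ≡ true → 0 < N L e
  occurs′ e P′e with ⌊ g ≟ e ⌋ in g≟e
  ... | false = subst (0 <_) (N-edge g e L ∙ cong (λ b → indicator b + N L e) g≟e) (occurs e P′e)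

module _ {n m : ℕ} (s t : Fin m → Fin n) where

  isOpen : List (LEdge s t) → Fin m → Bool
  isOpen T′ e = not (any (λ x → ⌊ LSrc s t x ≟ e ⌋) T′)

  source-closed : ∀ {T′ x} → x ∈ T′ → isOpen T′ (LSrc s t x) ≡ false
  source-closed {x ∷ T′} (here refl) rewrite ≟-refl (LSrc s t x) = refl
  source-closed {y ∷ T′} {x} (there x∈) with ⌊ LSrc s t y ≟ LSrc s t x ⌋
  ... | true  = refl
  ... | false = source-closed x∈

  open-after-adding : ∀ x T′ e → isOpen (x ∷ T′) e ≡ not ⌊ LSrc s t x ≟ e ⌋ ∧ isOpen T′ e
  open-after-adding x T′ e with ⌊ LSrc s t x ≟ e ⌋
  ... | true  = refl
  ... | false = refl

  open-no-arc : ∀ {f} (q : LEdge s t → Bool) T′ → isOpen T′ f ≡ true →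
                any (λ x → ⌊ LSrc s t x ≟ f ⌋ ∧ q x) T′ ≡ false
  open-no-arc q []       f-open = refl
  open-no-arc {f} q (x ∷ T′) f-open with ⌊ LSrc s t x ≟ f ⌋
  ... | false = open-no-arc q T′ f-open

  closing : ∀ x T′ (Q : Fin m → Bool) → isOpen T′ (LSrc s t x) ≡ true →
    count (λ e → Q e ∧ isOpen T′ e) (allFin m)
      ≡ indicator (Q (LSrc s t x)) + count (λ e → Q e ∧ isOpen (x ∷ T′) e) (allFin m)
  closing x T′ Q f-open =
    count-remove (λ e → Q e ∧ isOpen T′ e) f
    ∙ cong₂ _+_ (cong (λ b → indicator (Q f ∧ b)) f-open ∙ cong indicator (∧-identityʳ (Q f)))
                (count-cong (allFin m) others)
    where
    f : Fin m
    f = LSrc s t x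
    others : ∀ e → not ⌊ f ≟ e ⌋ ∧ (Q e ∧ isOpen T′ e) ≡ Q e ∧ isOpen (x ∷ T′) e
    others e rewrite open-after-adding x T′ e with ⌊ f ≟ e ⌋
    ... | true  = sym (∧-zeroʳ (Q e))
    ... | false = refl

  indeg-adding : ∀ x T′ e → isOpen T′ (LSrc s t x) ≡ true →
                 indegL s t (x ∷ T′) e ≡ indicator ⌊ LTgt s t x ≟ e ⌋ + indegL s t T′ e
  indeg-adding x T′ e f-open =
    count-remove arcInto′ f
    ∙ cong₂ _+_ (cong (λ b → indicator (b ∧ ⌊ LTgt s t x ≟ e ⌋ ∨ arcInto f)) (≟-refl f)
                 ∙ cong (λ b → indicator (⌊ LTgt s t x ≟ e ⌋ ∨ b)) no-arc-from-f
                 ∙ cong indicator (∨-identityʳ _))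
                (count-cong (allFin m) others
                 ∙ cong (λ b → indicator b + count (λ y → not ⌊ f ≟ y ⌋ ∧ arcInto y) (allFin m))
                        (sym no-arc-from-f)
                 ∙ sym (count-remove arcInto f))
    where
    f : Fin m
    f = LSrc s t x
    arcInto arcInto′ : Fin m → Bool
    arcInto  y = any (λ z → ⌊ LSrc s t z ≟ y ⌋ ∧ ⌊ LTgt s t z ≟ e ⌋) T′
    arcInto′ y = any (λ z → ⌊ LSrc s t z ≟ y ⌋ ∧ ⌊ LTgt s t z ≟ e ⌋) (x ∷ T′)
    no-arc-from-f : arcInto f ≡ false
    no-arc-from-f = open-no-arc (λ z → ⌊ LTgt s t z ≟ e ⌋) T′ f-open
    others : ∀ y → not ⌊ f ≟ y ⌋ ∧ arcInto′ y ≡ not ⌊ f ≟ y ⌋ ∧ arcInto y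
    others y with ⌊ f ≟ y ⌋
    ... | true  = refl
    ... | false = refl

module Run {n m : ℕ} (s t : Fin m → Fin n) (π : Permutation′ m)
           (l₀ : Fin n → List (Entry m)) (array : TreeArray s t l₀) where

  T : Subset m
  T = proj₁ array

  r : Fin n
  r = proj₁ (proj₂ array)

  tree : OrientedSpanningTree s t (_∈ₛ T) r
  tree = proj₁ (proj₂ (proj₂ array))

  LE : Set
  LE = LEdge s t

  data LastEntry (v : Fin n) : Entry m → Set where
    root      : v ≡ r → LastEntry v Ω
    tree-edge : ∀ {e} → v ≢ r → e ∈ₛ T → s e ≡ v → LastEntry v (edge e)

  -- the nonempty suffixes of a tree-array list at v
  data Live (v : Fin n) : List (Entry m) → Set where
    last : ∀ {x} → LastEntry v x → Live v [ x ]
    _∷_  : ∀ {e L} → s e ≡ v → Live v L → Live v (edge e ∷ L)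

  -- what may remain of the list at v while σ runs: only the list at the
  -- root keeps its final entry Ω until the very end
  data Remaining (v : Fin n) : List (Entry m) → Set where
    exhausted : v ≢ r → Remaining v []
    live      : ∀ {L} → Live v L → Remaining v L

  initially-live : ∀ v → Live v (l₀ v)
  initially-live v with proj₂ (proj₂ (proj₂ (proj₂ array)) v)
  ... | xs , x , l₀v≡ , out-edges , non-root , at-root =
    subst (Live v) (sym l₀v≡) (prefix out-edges final)
    where
    final : LastEntry v x
    final with v ≟ r
    ... | yes v≡r = subst (LastEntry v) (sym (at-root v≡r)) (root v≡r)
    ... | no  v≢r with non-root v≢r
    ...   | e , refl , e∈T , se≡v = tree-edge v≢r e∈T se≡v
    prefix : ∀ {ys} → All (λ y → ∃ λ e → y ≡ edge e × s e ≡ v) ys → LastEntry v x →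
             Live v (ys ++ [ x ])
    prefix []                          fin = last fin
    prefix ((e , refl , se≡v) ∷ rest) fin = se≡v ∷ prefix rest fin

  live-if-nonempty : ∀ {v L} → Remaining v L → 0 < length L → Live v L
  live-if-nonempty (live L) _ = L

  root-live : ∀ {L} → Remaining r L → Live r L
  root-live (exhausted r≢r) = ⊥-elim (r≢r refl)
  root-live (live L)        = L

  pop-edge : ∀ {v g rest} → Remaining v (edge g ∷ rest) → s g ≡ v × Remaining v rest
  pop-edge (live (last (tree-edge v≢r _ sg≡v))) = sg≡v , exhausted v≢r
  pop-edge (live (sg≡v ∷ L))                    = sg≡v , live L

  pop-Ω : ∀ {v rest} → Remaining v (Ω ∷ rest) → v ≡ r × rest ≡ []
  pop-Ω (live (last (root v≡r))) = v≡r , refl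

  tree-edge-pending : ∀ {v L} → v ≢ r → Live v L → ∃ λ e → e ∈ₛ T × s e ≡ v × 0 < N L e
  tree-edge-pending v≢r (last (root v≡r)) = ⊥-elim (v≢r v≡r)
  tree-edge-pending v≢r (last (tree-edge {e} _ e∈T se≡v)) =
    e , e∈T , se≡v , subst (0 <_) (sym (N-edge e e [] ∙ cong (λ b → indicator b + 0) (≟-refl e))) (s≤s z≤n)
  tree-edge-pending v≢r (_∷_ {g} _ L) with tree-edge-pending v≢r L
  ... | e , e∈T , se≡v , pending =
    e , e∈T , se≡v , ≤-trans pending (≤-trans (m≤n+m _ _) (≤-reflexive (sym (N-edge g e _))))

  root-not-all-edges : ∀ {L} → Live r L → count isEdgeEntry L < length L
  root-not-all-edges (last (root _))             = s≤s z≤n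
  root-not-all-edges (last (tree-edge r≢r _ _))  = ⊥-elim (r≢r refl)
  root-not-all-edges (_ ∷ L)                      = s≤s (root-not-all-edges L)

  ready : (Fin n → List (Entry m)) → List LE → Fin m → Bool
  ready = inR s t π

  ready-facts : ∀ l T′ f → ready l T′ f ≡ true → N (l (s f)) f ≡ 0 × isOpen s t T′ f ≡ true
  ready-facts l T′ f f∈R with N (l (s f)) f | isOpen s t T′ f
  ready-facts _ _ _ refl | zero  | true  = refl , refl
  ready-facts _ _ _ ()   | zero  | false
  ready-facts _ _ _ ()   | suc _ | _

  not-ready : ∀ l T′ e → ready l T′ e ≡ false → isOpen s t T′ e ≡ true → 0 < N (l (s e)) e
  not-ready l T′ e e∉R e-open with N (l (s e)) e | isOpen s t T′ e
  not-ready _ _ _ () _  | zero  | true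
  not-ready _ _ _ _  () | _     | false
  not-ready _ _ _ _  _  | suc _ | true = s≤s z≤n

  LWalk : List LE → List LE → Fin m → Fin m → Set
  LWalk T′ = IsWalk (LSrc s t) (LTgt s t) (_∈ T′)

  record Invariant (l : Fin n → List (Entry m)) (T′ : List LE) : Set where
    field
      remaining     : ∀ v → Remaining v (l v)
      length-open   : ∀ v → length (l v) ≡ count (λ e → ⌊ t e ≟ v ⌋ ∧ isOpen s t T′ e) (allFin m)
      pending-open  : ∀ e → 0 < N (l (s e)) e → isOpen s t T′ e ≡ true
      indeg-balance : ∀ e → indegL s t T′ e + N (l (s e)) e ≡ N (l₀ (s e)) e
      functional    : ∀ {x y} → x ∈ T′ → y ∈ T′ → LSrc s t x ≡ LSrc s t y → x ≡ y
      reaches-open  : ∀ e → ∃ λ u → ∃ λ ws → LWalk T′ ws e u × isOpen s t T′ u ≡ true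

  open Invariant

  open-into-nonempty : ∀ {l T′} → Invariant l T′ → ∀ {e} → isOpen s t T′ e ≡ true → 0 < length (l (t e))
  open-into-nonempty {T′ = T′} I {e} e-open rewrite length-open I (t e) =
    count-positive (λ x → ⌊ t x ≟ t e ⌋ ∧ isOpen s t T′ x) e (cong₂ _∧_ (≟-refl (t e)) e-open)

  module Step {l T′} (I : Invariant l T′) {f g rest} (f∈R : ready l T′ f ≡ true)
              (popped : l (t f) ≡ edge g ∷ rest) (sg≡tf : s g ≡ t f) where

    arc : LE
    arc = (f , g) , sym sg≡tf

    T″ : List LE
    T″ = arc ∷ T′

    -- l′ v is computed by the test v ≟ t f, so a case split on that test
    -- evaluates it
    l′ : Fin n → List (Entry m)
    l′ = update s t π l (t f) rest

    f-used-up : N (l (s f)) f ≡ 0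
    f-used-up = proj₁ (ready-facts l T′ f f∈R)

    f-open : isOpen s t T′ f ≡ true
    f-open = proj₂ (ready-facts l T′ f f∈R)

    open-after : ∀ {e} → e ≢ f → isOpen s t T″ e ≡ isOpen s t T′ e
    open-after {e} e≢f =
      open-after-adding s t arc T′ e
      ∙ cong (λ b → not b ∧ isOpen s t T′ e) (≟-≢ (λ f≡e → e≢f (sym f≡e)))

    length-pop : ∀ v → length (l v) ≡ indicator ⌊ t f ≟ v ⌋ + length (l′ v)
    length-pop v with v ≟ t f
    ... | yes refl = cong length popped ∙ cong (λ b → indicator b + length rest) (sym (≟-refl (t f)))
    ... | no v≢tf  = cong (λ b → indicator b + length (l v)) (sym (≟-≢ λ tf≡v → v≢tf (sym tf≡v)))

    N-pop : ∀ e → N (l (s e)) e ≡ indicator ⌊ g ≟ e ⌋ + N (l′ (s e)) e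
    N-pop e with s e ≟ t f
    ... | yes se≡tf = cong (λ v → N (l v) e) se≡tf ∙ cong (λ L → N L e) popped ∙ N-edge g e rest
    ... | no se≢tf  = cong (λ b → indicator b + N (l (s e)) e)
                           (sym (≟-≢ λ g≡e → se≢tf (cong s (sym g≡e) ∙ sg≡tf)))

    N-shrinks : ∀ e → N (l′ (s e)) e ≤ N (l (s e)) e
    N-shrinks e = ≤-trans (m≤n+m _ _) (≤-reflexive (sym (N-pop e)))

    g-pending : 0 < N (l (s g)) g
    g-pending = subst (0 <_) (sym listed-once) (s≤s z≤n)
      where
      listed-once : N (l (s g)) g ≡ suc (N rest g)
      listed-once = cong (λ v → N (l v) g) sg≡tf ∙ cong (λ L → N L g) popped ∙ N-edge g g rest
                    ∙ cong (λ b → indicator b + N rest g) (≟-refl g)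

    g-open : isOpen s t T′ g ≡ true
    g-open = pending-open I g g-pending

    f≢g : f ≢ g
    f≢g refl = case ≤-trans g-pending (≤-reflexive f-used-up) of λ ()

    invariant : Invariant l′ T″
    remaining invariant v with v ≟ t f
    ... | yes refl = proj₂ (pop-edge (subst (Remaining (t f)) popped (remaining I (t f))))
    ... | no _     = remaining I v
    length-open invariant v =
      +-cancelˡ-≡ (indicator ⌊ t f ≟ v ⌋) _ _
        (sym (length-pop v) ∙ length-open I v ∙ closing s t arc T′ (λ e → ⌊ t e ≟ v ⌋) f-open)
    pending-open invariant e pending′ with e ≟ f
    ... | yes refl = case ≤-trans pending′ (≤-trans (N-shrinks f) (≤-reflexive f-used-up)) of λ ()
    ... | no e≢f   = open-after e≢f ∙ pending-open I e (≤-trans pending′ (N-shrinks e))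
    indeg-balance invariant e = begin
      indegL s t T″ e + N (l′ (s e)) e
        ≡⟨ cong (_+ N (l′ (s e)) e) (indeg-adding s t arc T′ e f-open) ⟩
      indicator ⌊ g ≟ e ⌋ + indegL s t T′ e + N (l′ (s e)) e
        ≡⟨ xy∙z≈y∙xz (indicator ⌊ g ≟ e ⌋) _ _ ⟩
      indegL s t T′ e + (indicator ⌊ g ≟ e ⌋ + N (l′ (s e)) e)
        ≡⟨ cong (indegL s t T′ e +_) (N-pop e) ⟨
      indegL s t T′ e + N (l (s e)) e
        ≡⟨ indeg-balance I e ⟩
      N (l₀ (s e)) e
        ∎
      where open ≡-Reasoning
    functional invariant (here refl) (here refl) _ = refl
    functional invariant (here refl) (there y∈) f≡sy =
      case (sym (source-closed s t y∈) ∙ cong (isOpen s t T′) (sym f≡sy) ∙ f-open) of λ ()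
    functional invariant (there x∈) (here refl) sx≡f =
      case (sym (source-closed s t x∈) ∙ cong (isOpen s t T′) sx≡f ∙ f-open) of λ ()
    functional invariant (there x∈) (there y∈) sx≡sy = functional I x∈ y∈ sx≡sy
    reaches-open invariant e with reaches-open I e
    ... | u , ws , W , u-open with u ≟ f
    ...   | yes refl =
      g , ws ++ [ arc ]
        , walk-snoc (LSrc s t) (LTgt s t) arc (walk-mono (LSrc s t) (LTgt s t) there W) (here refl) refl
        , open-after (λ g≡f → f≢g (sym g≡f)) ∙ g-open
    ...   | no u≢f  = u , ws , walk-mono (LSrc s t) (LTgt s t) there W , open-after u≢f ∙ u-open

    fewer-open : count (isOpen s t T′) (allFin m) ≡ suc (count (isOpen s t T″) (allFin m))
    fewer-open = closing s t arc T′ (λ _ → true) f-open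

  -- Otherwise every open edge is still
  -- listed at its source, so the list at v holds at least as many edge
  -- entries as there are open edges out of v, and the list at the root one
  -- entry more (Ω).  Summed over v, both sides count the open edges.
  some-ready : ∀ {l T′} → Invariant l T′ → (∀ e → ready l T′ e ≡ false) → ⊥
  some-ready {l} {T′} I stuck = <-irrefl refl (begin-strict
    count open′ (allFin m)
      ≡⟨ double-counting s open′ (allFin m) ⟨
    sumOver out (allFin n)
      <⟨ sumOver-< (allFin n) out≤length (∈-allFin r) out<length ⟩
    sumOver (λ v → length (l v)) (allFin n)
      ≡⟨ sumOver-cong (allFin n) (length-open I) ⟩
    sumOver (λ v → count (λ e → ⌊ t e ≟ v ⌋ ∧ open′ e) (allFin m)) (allFin n)
      ≡⟨ double-counting t open′ (allFin m) ⟩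
    count open′ (allFin m)
      ∎)
    where
    open ≤-Reasoning
    open′ : Fin m → Bool
    open′ = isOpen s t T′
    out : Fin n → ℕ
    out v = count (λ e → ⌊ s e ≟ v ⌋ ∧ open′ e) (allFin m)
    out≤edges : ∀ v → out v ≤ count isEdgeEntry (l v)
    out≤edges v = distinct-occurrences (λ e → ⌊ s e ≟ v ⌋ ∧ open′ e) (l v) listed
      where
      listed : ∀ e → ⌊ s e ≟ v ⌋ ∧ open′ e ≡ true → 0 < N (l v) e
      listed e out-of-v with ∧-split ⌊ s e ≟ v ⌋ (open′ e) out-of-v
      ... | se≟v , e-open = subst (λ w → 0 < N (l w) e) (≟-sound se≟v) (not-ready l T′ e (stuck e) e-open)
    out≤length : ∀ v → out v ≤ length (l v)
    out≤length v = ≤-trans (out≤edges v) (length-filter (T? ∘ isEdgeEntry) (l v))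
    out<length : out r < length (l r)
    out<length = ≤-<-trans (out≤edges r) (root-not-all-edges (root-live (remaining I r)))

  Outcome : List LE → Set
  Outcome T′ = (∃ λ ρ → OrientedSpanningTree (LSrc s t) (LTgt s t) (_∈ T′) ρ)
             × (∀ e → indegL s t T′ e ≡ N (l₀ (s e)) e)

  module Final {l T′} (I : Invariant l T′) {f rest} (f∈R : ready l T′ f ≡ true)
               (popped : l (t f) ≡ Ω ∷ rest) where

    f-used-up : N (l (s f)) f ≡ 0
    f-used-up = proj₁ (ready-facts l T′ f f∈R)

    f-open : isOpen s t T′ f ≡ true
    f-open = proj₂ (ready-facts l T′ f f∈R)

    at-root : t f ≡ r × rest ≡ []
    at-root = pop-Ω (subst (Remaining (t f)) popped (remaining I (t f)))

    -- the list at the root was [Ω], so f is the only open edge into r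
    only-f-into-root : ∀ {e} → isOpen s t T′ e ≡ true → t e ≡ r → e ≡ f
    only-f-into-root {e} e-open te≡r with f ≟ e
    ... | yes f≡e = sym f≡e
    ... | no  f≢e =
      case ≤-trans (count-two into-r f e f≢e f-into-r e-into-r) (≤-reflexive just-one) of λ { (s≤s ()) }
      where
      into-r : Fin m → Bool
      into-r x = ⌊ t x ≟ r ⌋ ∧ isOpen s t T′ x
      f-into-r : into-r f ≡ true
      f-into-r = cong₂ _∧_ (cong (λ v → ⌊ v ≟ r ⌋) (proj₁ at-root) ∙ ≟-refl r) f-open
      e-into-r : into-r e ≡ true
      e-into-r = cong₂ _∧_ (cong (λ v → ⌊ v ≟ r ⌋) te≡r ∙ ≟-refl r) e-open
      just-one : count into-r (allFin m) ≡ 1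
      just-one = sym (length-open I r)
        ∙ cong length (cong l (sym (proj₁ at-root)) ∙ popped ∙ cong (Ω ∷_) (proj₂ at-root))

    -- Every open edge e is f, by induction along the tree walk from its
    -- head w to r.  If w = r, this is only-f-into-root.  Otherwise the list
    -- at w is nonempty (e enters w), so the tree edge e′ out of w is still
    -- listed there, hence open, hence e′ = f by induction; but f is used
    -- up at its source, so this case cannot occur.
    open-is-f-along : ∀ {ws w} → IsWalk s t (_∈ₛ T) ws w r →
                      ∀ {e} → isOpen s t T′ e ≡ true → t e ≡ w → e ≡ f
    open-is-f-along [] e-open te≡r = only-f-into-root e-open te≡r
    open-is-f-along (cons {e = e″} e″∈T refl W) {e} e-open te≡w with s e″ ≟ r
    ... | yes w≡r = only-f-into-root e-open (te≡w ∙ w≡r)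
    ... | no  w≢r
      with tree-edge-pending w≢r (live-if-nonempty (remaining I (s e″))
             (subst (λ v → 0 < length (l v)) te≡w (open-into-nonempty I e-open)))
    ...   | e′ , e′∈T , se′≡w , pending with tree-out-edge-unique s t tree e′∈T e″∈T se′≡w
    ...     | refl with open-is-f-along W (pending-open I e′ pending) refl
    ...       | refl = case ≤-trans pending (≤-reflexive f-used-up) of λ ()

    open-is-f : ∀ {e} → isOpen s t T′ e ≡ true → e ≡ f
    open-is-f {e} e-open = open-is-f-along (proj₂ (proj₁ (tree (t e)))) e-open refl

    -- every remaining occurrence would keep its edge open, i.e. equal to f
    used-up : ∀ e → N (l (s e)) e ≡ 0
    used-up e with N (l (s e)) e in Ne
    ... | zero  = refl
    ... | suc _ with open-is-f (pending-open I e (subst (0 <_) (sym Ne) (s≤s z≤n)))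
    ...   | refl = case sym Ne ∙ f-used-up of λ ()

    f-sink : ∀ {x} → x ∈ T′ → LSrc s t x ≢ f
    f-sink x∈ sx≡f = case sym (source-closed s t x∈) ∙ cong (isOpen s t T′) sx≡f ∙ f-open of λ ()

    -- T′ is an oriented spanning tree rooted at f, since every edge reaches
    -- the open edge f along T′, uniquely as T′ is functional; and as the
    -- lists are used up, indeg-balance gives the indegrees.
    outcome : Outcome T′
    outcome = (f , spanning) , indegrees
      where
      spanning : OrientedSpanningTree (LSrc s t) (LTgt s t) (_∈ T′) f
      spanning e with reaches-open I e
      ... | u , ws , W , u-open with open-is-f u-open
      ...   | refl = (ws , W) , λ _ _ → walk-unique (LSrc s t) (LTgt s t) (functional I) f-sink
      indegrees : ∀ e → indegL s t T′ e ≡ N (l₀ (s e)) e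
      indegrees e = sym (+-identityʳ _) ∙ cong (indegL s t T′ e +_) (sym (used-up e)) ∙ indeg-balance I e

  ordered-edges : ∀ e → e ∈ map (π ⟨$⟩ˡ_) (allFin m)
  ordered-edges e =
    subst (_∈ map (π ⟨$⟩ˡ_) (allFin m)) (inverseˡ π) (∈-map⁺ (π ⟨$⟩ˡ_) (∈-allFin (π ⟨$⟩ʳ e)))

  picked-ready : ∀ l T′ {f} → pick s t π l T′ ≡ just f → ready l T′ f ≡ true
  picked-ready l T′ = head-filter-just (ready l T′) (map (π ⟨$⟩ˡ_) (allFin m))

  -- Run from a state satisfying the invariant, σ-loop succeeds as soon as
  -- its fuel exceeds the number of open edges: each round closes an edge.
  loop : ∀ k {l T′} → Invariant l T′ → count (isOpen s t T′) (allFin m) < k →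
         ∃ λ T″ → σ-loop s t π k l T′ ≡ just T″ × Outcome T″
  loop (suc k) {l} {T′} I fuel with pick s t π l T′ in picked
  ... | nothing = ⊥-elim (some-ready I λ e →
                    head-filter-nothing (ready l T′) (map (π ⟨$⟩ˡ_) (allFin m)) picked (ordered-edges e))
  ... | just f with l (t f) in popped
  ...   | [] = case subst (λ L → 0 < length L) popped
                      (open-into-nonempty I (proj₂ (ready-facts l T′ f (picked-ready l T′ picked)))) of λ ()
  ...   | Ω ∷ rest = T′ , refl , Final.outcome I (picked-ready l T′ picked) popped
  ...   | edge g ∷ rest with s g ≟ t f
  ...     | no  sg≢tf = ⊥-elim (sg≢tf (proj₁ (pop-edge (subst (Remaining (t f)) popped (remaining I (t f))))))
  ...     | yes sg≡tf = loop k (Step.invariant I f∈R popped sg≡tf)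
                          (subst (_≤ k) (Step.fewer-open I f∈R popped sg≡tf) (s≤s⁻¹ fuel))
    where
    f∈R : ready l T′ f ≡ true
    f∈R = picked-ready l T′ picked

  initial : Invariant l₀ []
  remaining     initial v   = live (initially-live v)
  length-open   initial v   = proj₁ (proj₂ (proj₂ (proj₂ array)) v)
                              ∙ count-cong (allFin m) (λ e → sym (∧-identityʳ _))
  pending-open  initial e _ = refl
  indeg-balance initial e   = cong (_+ N (l₀ (s e)) e) (count-none (allFin m) (λ _ → refl))
  functional    initial ()
  reaches-open  initial e   = e , [] , [] , refl

  -- the fuel of σ is one more than the total length of the lists, which
  -- is the number of edges, all open at the start
  initial-fuel : count (isOpen s t []) (allFin m) < suc (sum (map (λ v → length (l₀ v)) (allFin n)))
  initial-fuel = s≤s (≤-reflexive (sym (sumOver-cong (allFin n) (length-open initial)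
                                         ∙ double-counting t (isOpen s t []) (allFin m))))

-- σ starts σ-loop from the initial state, which satisfies the invariant,
-- with more fuel than there are open edges; loop runs it to a successful
-- end.
lemma3p3 : ∀ {n m : ℕ} (s t : Fin m → Fin n)
           → (∀ v → 0 < indeg s t v)
           → (π : Permutation′ m)
           → (l : Fin n → List (Entry m))
           → TreeArray s t l
           → ∃ λ T' → σ s t π l ≡ just T'
               × (∃ λ ρ → OrientedSpanningTree (LSrc s t) (LTgt s t) (λ x → x ∈ T') ρ)
               × (∀ e → indegL s t T' e ≡ N (l (s e)) e)
lemma3p3 s t _ π l array = loop _ initial initial-fuel
  where open Run s t π l array
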